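{- Let $w$ be an infinite binary word. Then $\mathrm{PNF}_1(w)$ is the unique $1$-prefix normal infinite binary word $w'$ such that $F^1_{w'}=F^1_w$. Similarly, $\mathrm{PNF}_0(w)$ is the unique $0$-prefix normal infinite binary word $w''$ such that $F^0_{w''}=F^0_w$.
   Context: Binary words are indexed from $1$; $P_w(i)$ is the number of $1$s in the prefix of length $i$ of $w$. $F^1_w(i)$ (resp. $F^0_w(i)$) is the maximum number of $1$s (resp. $0$s) in a factor of $w$ of length $i$, with $F^a_w(0)=0$. An infinite word $w$ is $1$-prefix normal if $P_w(i)=F^1_w(i)$ for all $i\ge1$, and $0$-prefix normal if $i-P_w(i)=F^0_w(i)$ for all $i\ge1$. The prefix normal forms of $w$ are the infinite binary words $\mathrm{PNF}_1(w)=w'$ and $\mathrm{PNF}_0(w)=w''$ defined by $w'_n=F^1_w(n)-F^1_w(n-1)$ and $w''_n=1-(F^0_w(n)-F^0_w(n-1))$ for $n\ge1$. -}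

module Defs where

open import Data.Bool using (Bool; true; false)
open import Data.Nat using (ℕ; zero; suc; _+_; _∸_; _≤_)
open import Data.Product using (Σ; _×_)
open import Relation.Binary.PropositionalEquality using (_≡_)

-- An infinite binary word; position n (1-indexed in the paper) is  w (n - 1).
Word : Set
Word = ℕ → Bool

⟦_⟧₁ : Bool → ℕ
⟦ true ⟧₁ = 1
⟦ false ⟧₁ = 0

⟦_⟧₀ : Bool → ℕ
⟦ true ⟧₀ = 0
⟦ false ⟧₀ = 1

ones : Word → ℕ → ℕ → ℕ
ones w j zero = 0
ones w j (suc i) = ⟦ w j ⟧₁ + ones w (suc j) i

zeros : Word → ℕ → ℕ → ℕ
zeros w j zero = 0
zeros w j (suc i) = ⟦ w j ⟧₀ + zeros w (suc j) i

P : Word → ℕ → ℕ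
P w i = ones w 0 i

IsMaxOnes : Word → ℕ → ℕ → Set
IsMaxOnes w i m = Σ ℕ (λ j → ones w j i ≡ m) × ((j : ℕ) → ones w j i ≤ m)

IsMaxZeros : Word → ℕ → ℕ → Set
IsMaxZeros w i m = Σ ℕ (λ j → zeros w j i ≡ m) × ((j : ℕ) → zeros w j i ≤ m)

IsF1 : Word → (ℕ → ℕ) → Set
IsF1 w f = (i : ℕ) → IsMaxOnes w i (f i)

IsF0 : Word → (ℕ → ℕ) → Set
IsF0 w f = (i : ℕ) → IsMaxZeros w i (f i)

PrefixNormal1 : Word → Set
PrefixNormal1 w = (i : ℕ) → 1 ≤ i → IsMaxOnes w i (P w i)

PrefixNormal0 : Word → Set
PrefixNormal0 w = (i : ℕ) → 1 ≤ i → IsMaxZeros w i (i ∸ P w i)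

toBit : ℕ → Bool
toBit zero = false
toBit (suc _) = true

-- PNF_1(w) given F = F^1_w :  w'_n = F(n) - F(n-1), at 0-based position k = n - 1
PNF1 : (ℕ → ℕ) → Word
PNF1 F k = toBit (F (suc k) ∸ F k)

-- PNF_0(w) given G = F^0_w :  w''_n = 1 - (G(n) - G(n-1))
PNF0 : (ℕ → ℕ) → Word
PNF0 G k = toBit (1 ∸ (G (suc k) ∸ G k))

module Submission where

open import Defs
open import Data.Bool using (Bool; true; false)
open import Data.Nat using (ℕ; zero; suc; _+_; _∸_; _≤_; z≤n; s≤s)
open import Data.Nat.Properties
open import Data.Product using (_×_; _,_; Σ; proj₁; proj₂)
open import Relation.Binary.PropositionalEquality

-- F = F^1_w is zero at 0, grows by at most one per step and is subadditive.  The first two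
-- properties make the word of increments of F have prefix counts F; subadditivity then bounds
-- every other factor by a prefix, so PNF(F) is prefix normal with maximum function F.
-- Conversely, in a prefix normal word the prefix counts are the maximum function F, so its
-- letters are the increments of F.  The same argument counting 0s gives the PNF_0 half.

-- The counting function is a parameter, given with its defining equations, so that both
-- ones and zeros from Defs instantiate it and the statements match Defs definitionally.
module PrefixNormalForm
  (weight : Bool → ℕ) (decode : ℕ → Bool)
  (weight≤1 : ∀ b → weight b ≤ 1)
  (weight∘decode : ∀ x → x ≤ 1 → weight (decode x) ≡ x)
  (decode∘weight : ∀ b → decode (weight b) ≡ b)
  (count : Word → ℕ → ℕ → ℕ)
  (count-zero : ∀ w j → count w j zero ≡ 0)
  (count-suc : ∀ w j i → count w j (suc i) ≡ weight (w j) + count w (suc j) i)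
  where

  IsMax : Word → ℕ → ℕ → Set
  IsMax w i m = Σ ℕ (λ j → count w j i ≡ m) × ((j : ℕ) → count w j i ≤ m)

  IsMaxFunction : Word → (ℕ → ℕ) → Set
  IsMaxFunction w F = (i : ℕ) → IsMax w i (F i)

  PrefixNormal : Word → Set
  PrefixNormal w = (i : ℕ) → 1 ≤ i → IsMax w i (count w 0 i)

  normalForm : (ℕ → ℕ) → Word
  normalForm F k = decode (F (suc k) ∸ F k)

  count-+ : ∀ w j m n → count w j (m + n) ≡ count w j m + count w (j + m) n
  count-+ w j zero n = begin
    count w j n               ≡⟨ cong (λ k → count w k n) (sym (+-identityʳ j)) ⟩
    count w (j + 0) n         ≡⟨ cong (_+ count w (j + 0) n) (sym (count-zero w j)) ⟩
    count w j 0 + count w (j + 0) n ∎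
    where open ≡-Reasoning
  count-+ w j (suc m) n = begin
    count w j (suc (m + n))                               ≡⟨ count-suc w j (m + n) ⟩
    weight (w j) + count w (suc j) (m + n)                ≡⟨ cong (weight (w j) +_) (count-+ w (suc j) m n) ⟩
    weight (w j) + (count w (suc j) m + count w (suc j + m) n)
      ≡⟨ sym (+-assoc (weight (w j)) _ _) ⟩
    (weight (w j) + count w (suc j) m) + count w (suc j + m) n
      ≡⟨ cong₂ _+_ (sym (count-suc w j m)) (cong (λ k → count w k n) (sym (+-suc j m))) ⟩
    count w j (suc m) + count w (j + suc m) n ∎
    where open ≡-Reasoning

  count-snoc : ∀ w j i → count w j (suc i) ≡ count w j i + weight (w (j + i))
  count-snoc w j i = begin
    count w j (suc i)                  ≡⟨ cong (count w j) (+-comm 1 i) ⟩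
    count w j (i + 1)                  ≡⟨ count-+ w j i 1 ⟩
    count w j i + count w (j + i) 1    ≡⟨ cong (count w j i +_) (count-suc w (j + i) 0) ⟩
    count w j i + (weight (w (j + i)) + count w (suc (j + i)) 0)
      ≡⟨ cong (λ k → count w j i + (weight (w (j + i)) + k)) (count-zero w _) ⟩
    count w j i + (weight (w (j + i)) + 0)
      ≡⟨ cong (count w j i +_) (+-identityʳ _) ⟩
    count w j i + weight (w (j + i)) ∎
    where open ≡-Reasoning

  IsMax-unique : ∀ {w i a b} → IsMax w i a → IsMax w i b → a ≡ b
  IsMax-unique ((ja , ea) , a-max) ((jb , eb) , b-max) =
    ≤-antisym (subst (_≤ _) ea (b-max ja)) (subst (_≤ _) eb (a-max jb))

  module _ {w : Word} {F : ℕ → ℕ} (isMax : IsMaxFunction w F) where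

    maxFunction-zero : F 0 ≡ 0
    maxFunction-zero = trans (sym (proj₂ (proj₁ (isMax 0)))) (count-zero w _)

    maxFunction-mono : ∀ i → F i ≤ F (suc i)
    maxFunction-mono i with isMax i
    ... | (j , e) , _ = begin
      F i                                ≡⟨ sym e ⟩
      count w j i                        ≤⟨ m≤m+n _ _ ⟩
      count w j i + weight (w (j + i))   ≡⟨ sym (count-snoc w j i) ⟩
      count w j (suc i)                  ≤⟨ proj₂ (isMax (suc i)) j ⟩
      F (suc i)                          ∎
      where open ≤-Reasoning

    maxFunction-step : ∀ i → F (suc i) ≤ F i + 1
    maxFunction-step i with isMax (suc i)
    ... | (j , e) , _ = begin
      F (suc i)                          ≡⟨ sym e ⟩
      count w j (suc i)                  ≡⟨ count-snoc w j i ⟩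
      count w j i + weight (w (j + i))   ≤⟨ +-mono-≤ (proj₂ (isMax i) j) (weight≤1 _) ⟩
      F i + 1                            ∎
      where open ≤-Reasoning

    maxFunction-subadditive : ∀ m n → F (m + n) ≤ F m + F n
    maxFunction-subadditive m n with isMax (m + n)
    ... | (j , e) , _ = begin
      F (m + n)                          ≡⟨ sym e ⟩
      count w j (m + n)                  ≡⟨ count-+ w j m n ⟩
      count w j m + count w (j + m) n    ≤⟨ +-mono-≤ (proj₂ (isMax m) j) (proj₂ (isMax n) (j + m)) ⟩
      F m + F n                          ∎
      where open ≤-Reasoning

  module _ {F : ℕ → ℕ} (F-zero : F 0 ≡ 0)
           (F-mono : ∀ i → F i ≤ F (suc i)) (F-step : ∀ i → F (suc i) ≤ F i + 1) where

    weight-normalForm : ∀ k → weight (normalForm F k) ≡ F (suc k) ∸ F k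
    weight-normalForm k = weight∘decode _ (begin
      F (suc k) ∸ F k   ≤⟨ ∸-monoˡ-≤ (F k) (F-step k) ⟩
      F k + 1 ∸ F k     ≡⟨ m+n∸m≡n (F k) 1 ⟩
      1                 ∎)
      where open ≤-Reasoning

    normalForm-prefix : ∀ i → count (normalForm F) 0 i ≡ F i
    normalForm-prefix zero = trans (count-zero _ 0) (sym F-zero)
    normalForm-prefix (suc i) = begin
      count (normalForm F) 0 (suc i)               ≡⟨ count-snoc (normalForm F) 0 i ⟩
      count (normalForm F) 0 i + weight (normalForm F i)
        ≡⟨ cong₂ _+_ (normalForm-prefix i) (weight-normalForm i) ⟩
      F i + (F (suc i) ∸ F i)                      ≡⟨ m+[n∸m]≡n (F-mono i) ⟩
      F (suc i)                                    ∎
      where open ≡-Reasoning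

    normalForm-isMaxFunction : (∀ m n → F (m + n) ≤ F m + F n) →
                               IsMaxFunction (normalForm F) F
    normalForm-isMaxFunction F-sub i = (0 , normalForm-prefix i) , factor≤
      where
        factor≤ : ∀ j → count (normalForm F) j i ≤ F i
        factor≤ j = +-cancelˡ-≤ (F j) _ _ (begin
          F j + count (normalForm F) j i
            ≡⟨ cong (_+ count (normalForm F) j i) (sym (normalForm-prefix j)) ⟩
          count (normalForm F) 0 j + count (normalForm F) j i
            ≡⟨ sym (count-+ (normalForm F) 0 j i) ⟩
          count (normalForm F) 0 (j + i)   ≡⟨ normalForm-prefix (j + i) ⟩
          F (j + i)                        ≤⟨ F-sub j i ⟩
          F j + F i                        ∎)
          where open ≤-Reasoning

  prefixNormal-prefix : ∀ {v F} → PrefixNormal v → IsMaxFunction v F → ∀ i → count v 0 i ≡ F i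
  prefixNormal-prefix {v} v-normal isMax zero = trans (count-zero v 0) (sym (maxFunction-zero isMax))
  prefixNormal-prefix v-normal isMax (suc i) = IsMax-unique (v-normal (suc i) (s≤s z≤n)) (isMax (suc i))

  prefixNormal-unique : ∀ {v F} → PrefixNormal v → IsMaxFunction v F → ∀ n → v n ≡ normalForm F n
  prefixNormal-unique {v} {F} v-normal isMax n = begin
    v n                                     ≡⟨ sym (decode∘weight (v n)) ⟩
    decode (weight (v n))                   ≡⟨ cong decode (sym (m+n∸m≡n (count v 0 n) _)) ⟩
    decode (count v 0 n + weight (v n) ∸ count v 0 n)
      ≡⟨ cong (λ k → decode (k ∸ count v 0 n)) (sym (count-snoc v 0 n)) ⟩
    decode (count v 0 (suc n) ∸ count v 0 n)
      ≡⟨ cong decode (cong₂ _∸_ (prefix (suc n)) (prefix n)) ⟩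
    normalForm F n                          ∎
    where
      open ≡-Reasoning
      prefix = prefixNormal-prefix v-normal isMax

  normalForm-characterisation :
    ∀ {w F} → IsMaxFunction w F →
      (PrefixNormal (normalForm F) × IsMaxFunction (normalForm F) F)
      × ((v : Word) → PrefixNormal v → IsMaxFunction v F → ∀ n → v n ≡ normalForm F n)
  normalForm-characterisation {F = F} isMax =
      ( (λ i _ → subst (IsMax (normalForm F) i) (sym (prefix i)) (isMax′ i))
      , isMax′ )
    , λ v v-normal → prefixNormal-unique v-normal
    where
      prefix = normalForm-prefix (maxFunction-zero isMax) (maxFunction-mono isMax) (maxFunction-step isMax)
      isMax′ = normalForm-isMaxFunction (maxFunction-zero isMax) (maxFunction-mono isMax)
                 (maxFunction-step isMax) (maxFunction-subadditive isMax)

⟦⟧₁≤1 : ∀ b → ⟦ b ⟧₁ ≤ 1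
⟦⟧₁≤1 true = s≤s z≤n
⟦⟧₁≤1 false = z≤n

⟦toBit⟧₁ : ∀ x → x ≤ 1 → ⟦ toBit x ⟧₁ ≡ x
⟦toBit⟧₁ zero _ = refl
⟦toBit⟧₁ (suc zero) _ = refl
⟦toBit⟧₁ (suc (suc _)) (s≤s ())

toBit⟦⟧₁ : ∀ b → toBit ⟦ b ⟧₁ ≡ b
toBit⟦⟧₁ true = refl
toBit⟦⟧₁ false = refl

⟦⟧₀≤1 : ∀ b → ⟦ b ⟧₀ ≤ 1
⟦⟧₀≤1 true = z≤n
⟦⟧₀≤1 false = s≤s z≤n

⟦toBit1∸⟧₀ : ∀ x → x ≤ 1 → ⟦ toBit (1 ∸ x) ⟧₀ ≡ x
⟦toBit1∸⟧₀ zero _ = refl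
⟦toBit1∸⟧₀ (suc zero) _ = refl
⟦toBit1∸⟧₀ (suc (suc _)) (s≤s ())

toBit1∸⟦⟧₀ : ∀ b → toBit (1 ∸ ⟦ b ⟧₀) ≡ b
toBit1∸⟦⟧₀ true = refl
toBit1∸⟦⟧₀ false = refl

module Ones = PrefixNormalForm ⟦_⟧₁ toBit ⟦⟧₁≤1 ⟦toBit⟧₁ toBit⟦⟧₁
                ones (λ _ _ → refl) (λ _ _ _ → refl)
module Zeros = PrefixNormalForm ⟦_⟧₀ (λ x → toBit (1 ∸ x)) ⟦⟧₀≤1 ⟦toBit1∸⟧₀ toBit1∸⟦⟧₀
                 zeros (λ _ _ → refl) (λ _ _ _ → refl)

ones+zeros≡length : ∀ w j i → ones w j i + zeros w j i ≡ i
ones+zeros≡length w j zero = refl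
ones+zeros≡length w j (suc i) with w j
... | true = cong suc (ones+zeros≡length w (suc j) i)
... | false = trans (+-suc (ones w (suc j) i) _) (cong suc (ones+zeros≡length w (suc j) i))

length∸ones≡zeros : ∀ w j i → i ∸ ones w j i ≡ zeros w j i
length∸ones≡zeros w j i = begin
  i ∸ ones w j i                          ≡⟨ cong (_∸ ones w j i) (sym (ones+zeros≡length w j i)) ⟩
  ones w j i + zeros w j i ∸ ones w j i   ≡⟨ m+n∸m≡n (ones w j i) _ ⟩
  zeros w j i                             ∎
  where open ≡-Reasoning

prefixNormal0⇒ : ∀ {v} → PrefixNormal0 v → Zeros.PrefixNormal v
prefixNormal0⇒ {v} v-normal i i≥1 = subst (IsMaxZeros v i) (length∸ones≡zeros v 0 i) (v-normal i i≥1)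

prefixNormal0⇐ : ∀ {v} → Zeros.PrefixNormal v → PrefixNormal0 v
prefixNormal0⇐ {v} v-normal i i≥1 = subst (IsMaxZeros v i) (sym (length∸ones≡zeros v 0 i)) (v-normal i i≥1)

lemma8 : (w : Word) →
    ((F : ℕ → ℕ) → IsF1 w F →
      (PrefixNormal1 (PNF1 F) × IsF1 (PNF1 F) F)
      × ((v : Word) → PrefixNormal1 v → IsF1 v F → (n : ℕ) → v n ≡ PNF1 F n))
    × ((G : ℕ → ℕ) → IsF0 w G →
      (PrefixNormal0 (PNF0 G) × IsF0 (PNF0 G) G)
      × ((v : Word) → PrefixNormal0 v → IsF0 v G → (n : ℕ) → v n ≡ PNF0 G n))
lemma8 w = (λ _ → Ones.normalForm-characterisation) , zeroPart
  where
    zeroPart : (G : ℕ → ℕ) → IsF0 w G →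
      (PrefixNormal0 (PNF0 G) × IsF0 (PNF0 G) G)
      × ((v : Word) → PrefixNormal0 v → IsF0 v G → (n : ℕ) → v n ≡ PNF0 G n)
    zeroPart G isF0 with Zeros.normalForm-characterisation isF0
    ... | (normal , isMax) , unique =
      (prefixNormal0⇐ normal , isMax) , λ v v-normal → unique v (prefixNormal0⇒ v-normal)
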